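{- Let $m\geq 2$, $r\geq 1$, and let $M=(y_{ij})$ be an $m\times r$ integer matrix. Suppose that for some $k$ with $1\le k\le m$ the $k$th row of $M$ is entirely zero, i.e. $y_{k1}=\cdots=y_{kr}=0$. Let $M'$ be the $(m-1)\times r$ matrix obtained from $M$ by deleting the $k$th row. If $X$ and $X'$ are the standardized abelian Cayley graphs with Heuberger matrices $M$ and $M'$ respectively, then $\chi(X)=\chi(X')$.
   Context: Given an $m\times r$ integer matrix $M$, let $H$ be the subgroup of $\mathbb{Z}^m$ generated by the columns of $M$, let $e_1,\dots,e_m$ be the standard basis of $\mathbb{Z}^m$, and $S=\{H\pm e_1,\dots,H\pm e_m\}$. The standardized abelian Cayley graph with Heuberger matrix $M$ is $\mathrm{Cay}(\mathbb{Z}^m/H,S)$ (vertices $\mathbb{Z}^m/H$, $x\sim y$ iff $x-y\in S$; loops allowed, no multiple edges). $\chi$ denotes chromatic number; a graph with a loop has no proper coloring (its chromatic number is regarded as infinite). -}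

module Defs where

open import Data.Nat using (ℕ; zero; suc; _<_)
open import Data.Integer using (ℤ; _+_; _-_; _*_; 0ℤ; 1ℤ)
open import Data.Fin using (Fin; zero; suc; _≟_)
open import Data.Maybe using (Maybe; just; nothing)
open import Data.Product using (Σ; _×_)
open import Data.Sum using (_⊎_)
open import Relation.Nullary using (¬_; Dec; yes; no)
open import Relation.Binary.PropositionalEquality using (_≡_; _≢_)

Matrix : ℕ → ℕ → Set
Matrix m r = Fin m → Fin r → ℤ

Point : ℕ → Set
Point m = Fin m → ℤ

sumFin : ∀ {r} → (Fin r → ℤ) → ℤ
sumFin {zero} f = 0ℤ
sumFin {suc r} f = f zero + sumFin (λ j → f (suc j))

e : ∀ {m} → Fin m → Point m
e i j with i ≟ j
... | yes _ = 1ℤ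
... | no _ = 0ℤ

InH : ∀ {m r} → Matrix m r → Point m → Set
InH {m} {r} M v = Σ (Fin r → ℤ) λ c → ∀ i → v i ≡ sumFin (λ j → M i j * c j)

-- same vertex of ℤ^m / H
SameCoset : ∀ {m r} → Matrix m r → Point m → Point m → Set
SameCoset M x y = InH M (λ j → x j - y j)

-- adjacency in Cay(ℤ^m/H, {H ± e_i}) (on representatives): x - y ∈ H + e_i or H - e_i
Adj : ∀ {m r} → Matrix m r → Point m → Point m → Set
Adj {m} M x y = Σ (Fin m) λ i →
  InH M (λ j → (x j - y j) - e i j) ⊎ InH M (λ j → (x j - y j) + e i j)

-- proper coloring of the Cayley graph with n colours: a map on ℤ^m constant on
-- cosets of H (i.e. a map on ℤ^m/H) giving adjacent vertices distinct colours
-- (a loop makes this impossible)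
ProperColoring : ∀ {m r} → Matrix m r → ℕ → Set
ProperColoring {m} M n = Σ (Point m → Fin n) λ c →
  (∀ x y → SameCoset M x y → c x ≡ c y) × (∀ x y → Adj M x y → c x ≢ c y)

Colorable : ∀ {m r} → Matrix m r → ℕ → Set
Colorable M n = ProperColoring M n

-- χ(X) = χ, where nothing denotes ∞ (no proper coloring with finitely many colours)
IsChromaticNumber : ∀ {m r} → Matrix m r → Maybe ℕ → Set
IsChromaticNumber M (just n) = Colorable M n × (∀ k → k < n → ¬ Colorable M k)
IsChromaticNumber M nothing = ∀ n → ¬ Colorable M n

-- Since the k-th row of M vanishes, H lies in the hyperplane x_k = 0, so X is the
-- Cartesian product of X′ with the path ℤ (coordinate k). A proper colouring of X
-- restricts to X′ on the slice x_k = 0; conversely a colouring of X′ with at least two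
-- colours extends to X by applying a fixed-point-free permutation of the colours on the
-- odd slices. Neither graph has a proper colouring with fewer than two colours, since
-- e_1 is joined to 0 (or is a loop) in both.
module Submission where

open import Defs
open import Data.Nat as ℕ using (ℕ; suc; _≤_; s≤s; z≤n)
open import Data.Integer using (ℤ; 0ℤ; 1ℤ; +_; -[1+_]; _+_; _-_; _*_; -_)
open import Data.Integer.Properties using (i-j≡0⇒i≡j; +-identityʳ; +-inverseʳ; *-zeroʳ)
open import Data.Integer.Tactic.RingSolver using (solve-∀)
import Data.Nat.Properties as ℕ
open import Data.Nat.Base using (parity)
open import Data.Parity.Base using (Parity; 0ℙ; 1ℙ; _⁻¹)
open import Data.Parity.Properties using (suc-homo-⁻¹; ⁻¹-selfInverse; p≢p⁻¹)
open import Data.Fin using (Fin; zero; suc; punchIn; punchOut; fromℕ; inject₁; toℕ; _≟_)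
open import Data.Fin.Properties using (punchIn-punchOut; punchIn-injective; punchInᵢ≢i; fromℕ≢inject₁; inject₁-injective; toℕ-inject₁)
open import Data.Vec.Functional using (insertAt; removeAt)
open import Data.Vec.Functional.Properties using (insertAt-lookup; insertAt-punchIn)
open import Data.Maybe using (Maybe; just; nothing)
open import Data.Product using (_×_; _,_)
open import Data.Sum using (_⊎_; inj₁; inj₂)
open import Data.Empty using (⊥-elim)
open import Function using (_∘_)
open import Function.Bundles using (_⇔_; mk⇔; Equivalence)
open import Relation.Nullary using (¬_; yes; no; contradiction)
open import Relation.Binary.PropositionalEquality using (_≡_; _≢_; refl; sym; trans; cong; cong₂; subst)

data PunchView {n} (k : Fin (suc n)) : Fin (suc n) → Set where
  at      : PunchView k k
  punched : ∀ i → PunchView k (punchIn k i)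

punchView : ∀ {n} (k j : Fin (suc n)) → PunchView k j
punchView k j with k ≟ j
... | yes refl = at
... | no k≢j   = subst (PunchView k) (punchIn-punchOut k≢j) (punched (punchOut k≢j))

punchIn-elim : ∀ {n} {P : Fin (suc n) → Set} (k : Fin (suc n)) →
               P k → (∀ i → P (punchIn k i)) → ∀ j → P j
punchIn-elim k pk pi j with punchView k j
... | at        = pk
... | punched i = pi i

sumFin-zero : ∀ {r} (f : Fin r → ℤ) → (∀ j → f j ≡ 0ℤ) → sumFin f ≡ 0ℤ
sumFin-zero {ℕ.zero} f f≡0 = refl
sumFin-zero {suc r}  f f≡0 = cong₂ _+_ (f≡0 zero) (sumFin-zero (f ∘ suc) (f≡0 ∘ suc))

e-diagonal : ∀ {m} (i : Fin m) → e i i ≡ 1ℤ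
e-diagonal i with i ≟ i
... | yes _  = refl
... | no i≢i = contradiction refl i≢i

e-offDiagonal : ∀ {m} {i j : Fin m} → i ≢ j → e i j ≡ 0ℤ
e-offDiagonal {i = i} {j} i≢j with i ≟ j
... | yes i≡j = contradiction i≡j i≢j
... | no _    = refl

e-punchIn : ∀ {n} (k : Fin (suc n)) (i j : Fin n) → e (punchIn k i) (punchIn k j) ≡ e i j
e-punchIn k i j with punchIn k i ≟ punchIn k j | i ≟ j
... | yes _   | yes _   = refl
... | yes eq  | no i≢j  = contradiction (punchIn-injective k i j eq) i≢j
... | no ne   | yes i≡j = contradiction (cong (punchIn k) i≡j) ne
... | no _    | no _    = refl

InH-cong : ∀ {m r} {M : Matrix m r} {v w : Point m} → (∀ i → v i ≡ w i) → InH M v → InH M w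
InH-cong v≡w (a , v≡Ma) = a , λ i → trans (sym (v≡w i)) (v≡Ma i)

InH-zero : ∀ {m r} (M : Matrix m r) → InH M (λ _ → 0ℤ)
InH-zero M = (λ _ → 0ℤ) , λ i → sym (sumFin-zero _ (λ j → *-zeroʳ (M i j)))

Adj-basis : ∀ {m r} (M : Matrix m r) (i : Fin m) → Adj M (e i) (λ _ → 0ℤ)
Adj-basis M i = i , inj₁ (InH-cong {M = M} (λ j → sym (a-0-a≡0 (e i j))) (InH-zero M))
  where
  a-0-a≡0 : ∀ a → (a - 0ℤ) - a ≡ 0ℤ
  a-0-a≡0 a = trans (cong (_- a) (+-identityʳ a)) (+-inverseʳ a)

¬colorable-0 : ∀ {m r} (M : Matrix m r) → ¬ Colorable M 0
¬colorable-0 M (c , _) with c (λ _ → 0ℤ)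
... | ()

¬colorable-1 : ∀ {m r} (M : Matrix (suc m) r) → ¬ Colorable M 1
¬colorable-1 M (c , _ , proper) with c (e zero) in cx | c (λ _ → 0ℤ) in cy
... | zero | zero = proper _ _ (Adj-basis M zero) (trans cx (sym cy))

parityℤ : ℤ → Parity
parityℤ (+ n)    = parity n
parityℤ -[1+ n ] = parity (suc n)

parity-suc : ∀ n → parity (suc n) ≡ parity n ⁻¹
parity-suc n = sym (⁻¹-selfInverse (suc-homo-⁻¹ n))

parityℤ-+1 : ∀ a → parityℤ (a + 1ℤ) ≡ parityℤ a ⁻¹
parityℤ-+1 (+ n)        = subst (λ s → parity s ≡ parity n ⁻¹) (ℕ.+-comm 1 n) (parity-suc n)
parityℤ-+1 -[1+ 0 ]     = refl
parityℤ-+1 -[1+ suc n ] = parity-suc n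

≡+1⇒parityℤ-≢ : ∀ a b → a ≡ b + 1ℤ → parityℤ a ≢ parityℤ b
≡+1⇒parityℤ-≢ _ b refl eq = p≢p⁻¹ (parityℤ b) (trans (sym eq) (parityℤ-+1 b))

i-j-1≡0⇒i≡j+1 : ∀ a b → (a - b) - 1ℤ ≡ 0ℤ → a ≡ b + 1ℤ
i-j-1≡0⇒i≡j+1 a b eq = i-j≡0⇒i≡j a (b + 1ℤ) (trans (identity a b) eq)
  where identity : ∀ a b → a - (b + 1ℤ) ≡ (a - b) - 1ℤ
        identity = solve-∀

i-j+1≡0⇒j≡i+1 : ∀ a b → (a - b) + 1ℤ ≡ 0ℤ → b ≡ a + 1ℤ
i-j+1≡0⇒j≡i+1 a b eq = i-j≡0⇒i≡j b (a + 1ℤ) (trans (identity a b) (cong -_ eq))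
  where identity : ∀ a b → b - (a + 1ℤ) ≡ - ((a - b) + 1ℤ)
        identity = solve-∀

rotate : ∀ {n} → Fin (suc n) → Fin (suc n)
rotate zero    = fromℕ _
rotate (suc i) = inject₁ i

rotate-injective : ∀ {n} {i j : Fin (suc n)} → rotate i ≡ rotate j → i ≡ j
rotate-injective {i = zero}  {zero}  _  = refl
rotate-injective {i = zero}  {suc j} eq = contradiction eq fromℕ≢inject₁
rotate-injective {i = suc i} {zero}  eq = contradiction (sym eq) fromℕ≢inject₁
rotate-injective {i = suc i} {suc j} eq = cong suc (inject₁-injective eq)

rotate-fixedPointFree : ∀ {n} (i : Fin (suc (suc n))) → i ≢ rotate i
rotate-fixedPointFree zero    ()
rotate-fixedPointFree (suc i) eq = ℕ.1+n≢n (trans (cong toℕ eq) (toℕ-inject₁ i))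

twist : ∀ {n} → Parity → Fin (suc n) → Fin (suc n)
twist 0ℙ = λ v → v
twist 1ℙ = rotate

twist-injective : ∀ {n} p {u v : Fin (suc n)} → twist p u ≡ twist p v → u ≡ v
twist-injective 0ℙ eq = eq
twist-injective 1ℙ eq = rotate-injective eq

twist-separates : ∀ {n} {p q} (v : Fin (suc (suc n))) → p ≢ q → twist p v ≢ twist q v
twist-separates {p = 0ℙ} {0ℙ} v p≢q = contradiction refl p≢q
twist-separates {p = 0ℙ} {1ℙ} v _   = rotate-fixedPointFree v
twist-separates {p = 1ℙ} {0ℙ} v _   = rotate-fixedPointFree v ∘ sym
twist-separates {p = 1ℙ} {1ℙ} v p≢q = contradiction refl p≢q

module ZeroRow {n r} {M : Matrix (suc n) r} {k : Fin (suc n)} (zeroRow : ∀ j → M k j ≡ 0ℤ) where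

  M′ : Matrix n r
  M′ = removeAt M k

  insert0 : Point n → Point (suc n)
  insert0 p = insertAt p k 0ℤ

  insert0-diff-at : ∀ p q → insert0 p k - insert0 q k ≡ 0ℤ
  insert0-diff-at p q = cong₂ _-_ (insertAt-lookup p k 0ℤ) (insertAt-lookup q k 0ℤ)

  insert0-diff-punchIn : ∀ p q j → insert0 p (punchIn k j) - insert0 q (punchIn k j) ≡ p j - q j
  insert0-diff-punchIn p q j = cong₂ _-_ (insertAt-punchIn p k 0ℤ j) (insertAt-punchIn q k 0ℤ j)

  InH-zeroRow : ∀ {v} → InH M v ⇔ (v k ≡ 0ℤ × InH M′ (removeAt v k))
  InH-zeroRow {v} = mk⇔
    (λ (a , v≡Ma) → trans (v≡Ma k) (Mka≡0 a) , a , v≡Ma ∘ punchIn k)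
    (λ (vk≡0 , a , v≡M′a) → a , punchIn-elim k (trans vk≡0 (sym (Mka≡0 a))) v≡M′a)
    where
    Mka≡0 : ∀ a → sumFin (λ j → M k j * a j) ≡ 0ℤ
    Mka≡0 a = sumFin-zero _ (λ j → cong (_* a j) (zeroRow j))

  SameCoset-removeAt : ∀ x y → SameCoset M x y → x k ≡ y k × SameCoset M′ (removeAt x k) (removeAt y k)
  SameCoset-removeAt x y h with Equivalence.to InH-zeroRow h
  ... | xk-yk≡0 , h′ = i-j≡0⇒i≡j (x k) (y k) xk-yk≡0 , h′

  SameCoset-insert0 : ∀ p q → SameCoset M′ p q → SameCoset M (insert0 p) (insert0 q)
  SameCoset-insert0 p q h = Equivalence.from InH-zeroRow
    (insert0-diff-at p q , InH-cong {M = M′} (sym ∘ insert0-diff-punchIn p q) h)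

  -- _⊕_ is _-_ or _+_, for the generators H - e i and H + e i respectively.
  module Edge (_⊕_ : ℤ → ℤ → ℤ) (⊕-identityʳ : ∀ a → a ⊕ 0ℤ ≡ a) where

    Edge : ∀ {m} → Matrix m r → Point m → Point m → Fin m → Set
    Edge N x y i = InH N (λ j → (x j - y j) ⊕ e i j)

    Edge-insert0 : ∀ p q i → Edge M′ p q i → Edge M (insert0 p) (insert0 q) (punchIn k i)
    Edge-insert0 p q i h = Equivalence.from InH-zeroRow
      ( trans (cong₂ _⊕_ (insert0-diff-at p q) (e-offDiagonal (punchInᵢ≢i k i))) (⊕-identityʳ 0ℤ)
      , InH-cong {M = M′} (λ j → sym (cong₂ _⊕_ (insert0-diff-punchIn p q j) (e-punchIn k i j))) h)

    Edge-punchIn : ∀ x y i → Edge M x y (punchIn k i) →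
                   x k ≡ y k × Edge M′ (removeAt x k) (removeAt y k) i
    Edge-punchIn x y i h with Equivalence.to InH-zeroRow h
    ... | hk , h′ =
      i-j≡0⇒i≡j (x k) (y k)
        (trans (sym (⊕-identityʳ _)) (trans (cong (_ ⊕_) (sym (e-offDiagonal (punchInᵢ≢i k i)))) hk))
      , InH-cong {M = M′} (λ j → cong (_ ⊕_) (e-punchIn k i j)) h′

    Edge-at : ∀ x y → Edge M x y k →
              (x k - y k) ⊕ 1ℤ ≡ 0ℤ × SameCoset M′ (removeAt x k) (removeAt y k)
    Edge-at x y h with Equivalence.to InH-zeroRow h
    ... | hk , h′ =
      trans (cong (_ ⊕_) (sym (e-diagonal k))) hk
      , InH-cong {M = M′} (λ j → trans (cong ((x (punchIn k j) - y (punchIn k j)) ⊕_)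
                                              (e-offDiagonal (punchInᵢ≢i k j ∘ sym)))
                                        (⊕-identityʳ _)) h′

  module E⁻ = Edge _-_ +-identityʳ
  module E⁺ = Edge _+_ +-identityʳ

  Adj-insert0 : ∀ p q → Adj M′ p q → Adj M (insert0 p) (insert0 q)
  Adj-insert0 p q (i , inj₁ h) = punchIn k i , inj₁ (E⁻.Edge-insert0 p q i h)
  Adj-insert0 p q (i , inj₂ h) = punchIn k i , inj₂ (E⁺.Edge-insert0 p q i h)

  Adj-removeAt : ∀ x y → Adj M x y →
                 (x k ≡ y k × Adj M′ (removeAt x k) (removeAt y k))
                 ⊎ (parityℤ (x k) ≢ parityℤ (y k) × SameCoset M′ (removeAt x k) (removeAt y k))
  Adj-removeAt x y (i , edge) with punchView k i | edge
  ... | punched i | inj₁ h = let xk≡yk , h′ = E⁻.Edge-punchIn x y i h in inj₁ (xk≡yk , i , inj₁ h′)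
  ... | punched i | inj₂ h = let xk≡yk , h′ = E⁺.Edge-punchIn x y i h in inj₁ (xk≡yk , i , inj₂ h′)
  ... | at        | inj₁ h = let d , h′ = E⁻.Edge-at x y h in
                             inj₂ (≡+1⇒parityℤ-≢ (x k) (y k) (i-j-1≡0⇒i≡j+1 (x k) (y k) d) , h′)
  ... | at        | inj₂ h = let d , h′ = E⁺.Edge-at x y h in
                             inj₂ (≡+1⇒parityℤ-≢ (y k) (x k) (i-j+1≡0⇒j≡i+1 (x k) (y k) d) ∘ sym , h′)

  colorable-removeAt : ∀ {c} → Colorable M c → Colorable M′ c
  colorable-removeAt (col , const , proper) =
    col ∘ insert0 , (λ p q → const _ _ ∘ SameCoset-insert0 p q) , (λ p q → proper _ _ ∘ Adj-insert0 p q)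

  colorable-extend : ∀ {c} → Colorable M′ (suc (suc c)) → Colorable M (suc (suc c))
  colorable-extend (col′ , const′ , proper′) = col , const , proper
    where
    col : Point (suc n) → Fin _
    col x = twist (parityℤ (x k)) (col′ (removeAt x k))

    const : ∀ x y → SameCoset M x y → col x ≡ col y
    const x y h with SameCoset-removeAt x y h
    ... | xk≡yk , h′ = cong₂ twist (cong parityℤ xk≡yk) (const′ _ _ h′)

    proper : ∀ x y → Adj M x y → col x ≢ col y
    proper x y a with Adj-removeAt x y a
    ... | inj₁ (xk≡yk , a′) = λ eq →
      proper′ _ _ a′ (twist-injective (parityℤ (y k))
        (subst (λ p → twist p (col′ (removeAt x k)) ≡ col y) (cong parityℤ xk≡yk) eq))
    ... | inj₂ (parities≢ , h′) = λ eq →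
      twist-separates (col′ (removeAt y k)) parities≢
        (trans (cong (twist (parityℤ (x k))) (sym (const′ _ _ h′))) eq)

colorable-removeZeroRow : ∀ {n r} (M : Matrix (suc (suc n)) r) k → (∀ j → M k j ≡ 0ℤ) →
                          ∀ c → Colorable M c ⇔ Colorable (removeAt M k) c
colorable-removeZeroRow M k _ ℕ.zero =
  mk⇔ (⊥-elim ∘ ¬colorable-0 M) (⊥-elim ∘ ¬colorable-0 (removeAt M k))
colorable-removeZeroRow M k _ 1 =
  mk⇔ (⊥-elim ∘ ¬colorable-1 M) (⊥-elim ∘ ¬colorable-1 (removeAt M k))
colorable-removeZeroRow M k zeroRow (suc (suc c)) = mk⇔ colorable-removeAt colorable-extend
  where open ZeroRow {M = M} {k} zeroRow

IsChromaticNumber-cong : ∀ {m m′ r r′} {M : Matrix m r} {N : Matrix m′ r′} →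
                         (∀ c → Colorable M c ⇔ Colorable N c) →
                         ∀ χ → IsChromaticNumber M χ ⇔ IsChromaticNumber N χ
IsChromaticNumber-cong M⇔N (just c) = mk⇔
  (λ (col , minimal) → to (M⇔N c) col , λ c′ c′<c → minimal c′ c′<c ∘ from (M⇔N c′))
  (λ (col , minimal) → from (M⇔N c) col , λ c′ c′<c → minimal c′ c′<c ∘ to (M⇔N c′))
  where open Equivalence
IsChromaticNumber-cong M⇔N nothing = mk⇔
  (λ none c → none c ∘ from (M⇔N c))
  (λ none c → none c ∘ to (M⇔N c))
  where open Equivalence

lemma2p8 : (n r : ℕ) → 1 ≤ n → 1 ≤ r → (M : Matrix (suc n) r) → (k : Fin (suc n)) →
    (∀ j → M k j ≡ 0ℤ) →
    (χ : Maybe ℕ) → IsChromaticNumber M χ ⇔ IsChromaticNumber (λ i j → M (punchIn k i) j) χ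
lemma2p8 (suc n) r (s≤s z≤n) _ M k zeroRow = IsChromaticNumber-cong (colorable-removeZeroRow M k zeroRow)
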